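{- Let $p\ge 5$ be a prime, $t\ge3$, and $k_1,\dots,k_t$ nonnegative integers with $$\max_{1\le i\le t}k_i\le p-2\quad\text{and}\quad\sum_{i=1}^t k_i\ge (p-2)t-p+1.$$ Let $H$ be either a $(k_1,\dots,k_t)$-necklace or a $(k_1,\dots,k_t)$-crown-necklace (as defined in the context), with end vertex set $W=\{x_1,\dots,x_t\}$. Then every map $\omega:W\to\{0,\dots,p-1\}$ that is a $C_p$-coloring of the induced subgraph $H[W]$ extends to a $C_p$-coloring of $H$.
   Context: A $C_p$-coloring of a graph $H$ is a map $\varphi:V(H)\to\{0,\dots,p-1\}$ with $\frac{p-1}{2}\le|\varphi(u)-\varphi(v)|\le\frac{p+1}{2}$ for every edge $uv$. An $m$-thread from $a$ to $b$ is a path from $a$ to $b$ with $m$ internal vertices. An $m$-necklace from $a$ to $b$ is a graph obtained from an $m$-thread from $a$ to $b$ by replacing some of its edges $uv$ by a $p$-cycle through $u$ and $v$ (all other vertices of that cycle new), i.e. the path's edges are replaced one by one by either an edge or such a $p$-cycle, pieces sharing only consecutive path vertices. A $(k_1,\dots,k_t)$-necklace ($t\ge3$) with center $y$ is the union of $t$ necklaces, the $i$-th a $k_i$-necklace from $y$ to an end vertex $x_i$, pairwise sharing no vertices other than $y$ and possibly end vertices. A $(k_1,\dots,k_t)$-crown-necklace is obtained from a $(k_1,\dots,k_t)$-necklace by replacing the center by a $p$-cycle $Q$: it is the union of a $p$-cycle $Q$ and $t$ necklaces, the $i$-th a $k_i$-necklace from a vertex $y_i\in V(Q)$ (the $y_i$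 not necessarily distinct) to an end vertex $x_i$, where the necklaces meet $Q$ only in the $y_i$ and meet each other only in vertices of $Q$ and possibly end vertices. -}

module Defs where

open import Data.Nat using (ℕ; zero; suc; _+_; _*_; _∸_; _≤_; ∣_-_∣)
open import Data.Fin using (Fin; toℕ; fromℕ; inject₁) renaming (zero to fzero; suc to fsuc)
open import Data.Product using (Σ; Σ-syntax; _×_)
open import Data.Sum using (_⊎_)
open import Data.Empty using (⊥)
open import Relation.Binary.PropositionalEquality using (_≡_; _≢_)
open import Function.Definitions using (Injective)

record Graph : Set₁ where
  field
    n      : ℕ
    E      : Fin n → Fin n → Set
    sym    : ∀ {u w} → E u w → E w u
    irrefl : ∀ {u} → E u u → ⊥

open Graph public

Vtx : Graph → Set
Vtx G = Fin (n G)

-- C_p-colorings:  (p-1)/2 ≤ |a - b| ≤ (p+1)/2, multiplied by 2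

CpOK : (p : ℕ) → Fin p → Fin p → Set
CpOK p a b = (p ∸ 1 ≤ 2 * ∣ toℕ a - toℕ b ∣) × (2 * ∣ toℕ a - toℕ b ∣ ≤ p + 1)

IsCpColoring : (G : Graph) (p : ℕ) → (Vtx G → Fin p) → Set
IsCpColoring G p φ = ∀ u w → E G u w → CpOK p (φ u) (φ w)

Next : (p : ℕ) → Fin p → Fin p → Set
Next p i j = (toℕ j ≡ suc (toℕ i)) ⊎ ((suc (toℕ i) ≡ p) × (toℕ j ≡ 0))

IsCycle : (G : Graph) (p : ℕ) → (Fin p → Vtx G) → Set
IsCycle G p c = Injective _≡_ _≡_ c × (∀ i j → Next p i j → E G (c i) (c j))

CycV : (G : Graph) (p : ℕ) → (Fin p → Vtx G) → Vtx G → Set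
CycV G p c z = Σ[ i ∈ Fin p ] z ≡ c i

CycE : (G : Graph) (p : ℕ) → (Fin p → Vtx G) → Vtx G → Vtx G → Set
CycE G p c u w = Σ[ i ∈ Fin p ] Σ[ j ∈ Fin p ]
  (Next p i j × (((u ≡ c i) × (w ≡ c j)) ⊎ ((u ≡ c j) × (w ≡ c i))))

-- A piece of a necklace replacing the path edge u w: either the edge
-- itself or a p-cycle through u and w (u, w at arbitrary positions).

data Piece (G : Graph) (p : ℕ) (u w : Vtx G) : Set where
  edge : E G u w → Piece G p u w
  cyc  : (c : Fin p → Vtx G) → IsCycle G p c →
         (i₁ i₂ : Fin p) → c i₁ ≡ u → c i₂ ≡ w → Piece G p u w

PieceV : {G : Graph} {p : ℕ} {u w : Vtx G} → Piece G p u w → Vtx G → Set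
PieceV {u = u} {w} (edge _) z = (z ≡ u) ⊎ (z ≡ w)
PieceV {G} {p} (cyc c _ _ _ _ _) z = CycV G p c z

PieceE : {G : Graph} {p : ℕ} {u w : Vtx G} → Piece G p u w → Vtx G → Vtx G → Set
PieceE {u = u} {w} (edge _) a b = ((a ≡ u) × (b ≡ w)) ⊎ ((a ≡ w) × (b ≡ u))
PieceE {G} {p} (cyc c _ _ _ _ _) a b = CycE G p c a b

-- An m-necklace from a to b in G: path vertices v 0 = a, …, v (m+1) = b
-- (distinct), piece j replaces the path edge v j — v (j+1); distinct
-- pieces share only common consecutive path vertices (so all other
-- vertices of the cycles are new).

record Necklace (G : Graph) (p m : ℕ) (a b : Vtx G) : Set where
  field
    v       : Fin (suc (suc m)) → Vtx G
    v-inj   : Injective _≡_ _≡_ v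
    v-start : v fzero ≡ a
    v-end   : v (fromℕ (suc m)) ≡ b
    piece   : (j : Fin (suc m)) → Piece G p (v (inject₁ j)) (v (fsuc j))
    disjoint : ∀ j j' → j ≢ j' → ∀ z →
      PieceV (piece j) z → PieceV (piece j') z →
      Σ[ l ∈ Fin (suc (suc m)) ] ((z ≡ v l)
        × ((l ≡ inject₁ j) ⊎ (l ≡ fsuc j))
        × ((l ≡ inject₁ j') ⊎ (l ≡ fsuc j')))

  NV : Vtx G → Set
  NV z = Σ[ j ∈ Fin (suc m) ] PieceV (piece j) z

  NE : Vtx G → Vtx G → Set
  NE a' b' = Σ[ j ∈ Fin (suc m) ] PieceE (piece j) a' b'

open Necklace public using (NV; NE)

-- G is a (k_1,…,k_t)-necklace with center y and end vertices x_1,…,x_t.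
-- Necklaces pairwise share only y and common end vertices; G is exactly
-- the union of the necklaces.

record IsMultiNecklace (G : Graph) (p t : ℕ) (k : Fin t → ℕ)
                       (x : Fin t → Vtx G) : Set where
  field
    y        : Vtx G
    neck     : (i : Fin t) → Necklace G p (k i) y (x i)
    disjoint : ∀ i i' → i ≢ i' → ∀ z → NV (neck i) z → NV (neck i') z →
               (z ≡ y) ⊎ ((z ≡ x i) × (z ≡ x i'))
    coverV   : ∀ z → Σ[ i ∈ Fin t ] NV (neck i) z
    coverE   : ∀ u w → E G u w → Σ[ i ∈ Fin t ] NE (neck i) u w

-- G is a (k_1,…,k_t)-crown-necklace with p-cycle Q, attachment vertices
-- y_i = Q (ys i) (not necessarily distinct) and end vertices x_1,…,x_t.

record IsCrownNecklace (G : Graph) (p t : ℕ) (k : Fin t → ℕ)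
                       (x : Fin t → Vtx G) : Set where
  field
    Q        : Fin p → Vtx G
    Q-cycle  : IsCycle G p Q
    ys       : Fin t → Fin p
    neck     : (i : Fin t) → Necklace G p (k i) (Q (ys i)) (x i)
    meetQ    : ∀ i z → NV (neck i) z → CycV G p Q z → z ≡ Q (ys i)
    disjoint : ∀ i i' → i ≢ i' → ∀ z → NV (neck i) z → NV (neck i') z →
               CycV G p Q z ⊎ ((z ≡ x i) × (z ≡ x i'))
    coverV   : ∀ z → CycV G p Q z ⊎ (Σ[ i ∈ Fin t ] NV (neck i) z)
    coverE   : ∀ u w → E G u w → CycE G p Q u w ⊎ (Σ[ i ∈ Fin t ] NE (neck i) u w)

module Submission where

-- Write p = 2h + 1.  Multiplying by h turns residues differing by ±1 into C_p-adjacent colours, so it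
-- suffices to label H by residues mod p, adjacent vertices differing by ±1 and x_i labelled h⁻¹ω_i.
-- Along a necklace such a labelling is fixed by the label c of its start and one sign per piece:
-- crossing the piece from u to w adds ±d, where d ≢ 0 is the number of cycle steps from u to w (1 for
-- an edge).  For nonzero d_1, …, d_n the residues x with x + Σ ±d_j ≡ 0 for some signs form a set of
-- size at least n + 1 (a further step either enlarges it or makes it invariant under a nonzero
-- translation, hence everything as p is prime).  So at most p − k_i − 2 starting labels fail to close
-- necklace i at its prescribed end, and Σ (p − k_i − 2) < p by hypothesis: one label c serves all
-- necklaces.  For a crown necklace the cycle Q is labelled c + q and necklace i starts at c + y_i.

open import Data.Bool using (Bool; true; false; not; _∨_; T)
open import Data.Bool.Properties using (T-∨; T?)
open import Data.Empty using (⊥-elim)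
open import Data.Fin using (Fin; toℕ; fromℕ; fromℕ<; inject₁) renaming (zero to fzero; suc to fsuc)
open import Data.Fin.Properties using (toℕ-injective; toℕ-fromℕ<; toℕ<n; toℕ-inject₁; _≟_)
open import Data.List using (tabulate)
open import Data.List.Properties using (tabulate-cong)
open import Data.Nat hiding (_≟_)
open import Data.Nat.Coprimality using (coprime-Bézout; prime⇒coprime)
open import Data.Nat.DivMod
open import Data.Nat.Divisibility using (_∣_; divides; m%n≡0⇒n∣m; n∣m⇒m%n≡0)
open import Data.Nat.GCD using (module Bézout)
open import Data.Nat.ListAction using (sum)
open import Data.Nat.Primality using (Prime; euclidsLemma; prime⇒irreducible)
open import Data.Nat.Properties hiding (_≟_)
open import Data.Nat.Tactic.RingSolver using (solve-∀)
open import Data.Product using (Σ; Σ-syntax; ∃; ∃-syntax; _×_; _,_; proj₁; proj₂; map₂)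
open import Data.Sum using (_⊎_; inj₁; inj₂; [_,_]; [_,_]′)
open import Defs hiding (sym; n)
open import Function using (_∘_; const)
open import Function.Bundles using (Equivalence)
open import Level using (0ℓ)
open import Relation.Binary.Bundles using (Setoid)
open import Relation.Binary.PropositionalEquality hiding ([_])
import Relation.Binary.Reasoning.Setoid as SetoidReasoning
open import Relation.Nullary using (¬_; contradiction; Dec; yes; no; ¬?; _×-dec_)
open import Relation.Nullary.Decidable using (decidable-stable)

open import Algebra.Properties.CommutativeSemigroup +-commutativeSemigroup using ()
  renaming (interchange to +-interchange; x∙yz≈y∙xz to x+[y+z]≡y+[x+z];
            xy∙z≈xz∙y to x+y+z≡x+z+y; xy∙z≈x∙zy to x+y+z≡x+[z+y])
open import Algebra.Properties.CommutativeSemigroup *-commutativeSemigroup using ()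
  renaming (xy∙z≈xz∙y to x*y*z≡x*z*y)

-- Sums over initial segments of ℕ and counting

sumBelow : ℕ → (ℕ → ℕ) → ℕ
sumBelow zero    f = 0
sumBelow (suc n) f = sumBelow n f + f n

module _ {f g : ℕ → ℕ} where

  sumBelow-cong : ∀ n → (∀ {x} → x < n → f x ≡ g x) → sumBelow n f ≡ sumBelow n g
  sumBelow-cong zero    f≡g = refl
  sumBelow-cong (suc n) f≡g = cong₂ _+_ (sumBelow-cong n (f≡g ∘ m<n⇒m<1+n)) (f≡g ≤-refl)

  sumBelow-mono-≤ : ∀ n → (∀ {x} → x < n → f x ≤ g x) → sumBelow n f ≤ sumBelow n g
  sumBelow-mono-≤ zero    f≤g = z≤n
  sumBelow-mono-≤ (suc n) f≤g = +-mono-≤ (sumBelow-mono-≤ n (f≤g ∘ m<n⇒m<1+n)) (f≤g ≤-refl)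

  sumBelow-mono-< : ∀ n → (∀ {x} → x < n → f x ≤ g x) →
                    ∀ {y} → y < n → f y < g y → sumBelow n f < sumBelow n g
  sumBelow-mono-< (suc n) f≤g {y} y<1+n fy<gy with m<1+n⇒m<n∨m≡n y<1+n
  ... | inj₁ y<n  = +-mono-<-≤ (sumBelow-mono-< n (f≤g ∘ m<n⇒m<1+n) y<n fy<gy) (f≤g ≤-refl)
  ... | inj₂ refl = +-mono-≤-< (sumBelow-mono-≤ n (f≤g ∘ m<n⇒m<1+n)) fy<gy

  sumBelow-distrib-+ : ∀ n → sumBelow n (λ x → f x + g x) ≡ sumBelow n f + sumBelow n g
  sumBelow-distrib-+ zero    = refl
  sumBelow-distrib-+ (suc n) = begin
    sumBelow n (λ x → f x + g x) + (f n + g n)  ≡⟨ cong (_+ (f n + g n)) (sumBelow-distrib-+ n) ⟩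
    sumBelow n f + sumBelow n g + (f n + g n)   ≡⟨ +-interchange (sumBelow n f) _ _ _ ⟩
    sumBelow n f + f n + (sumBelow n g + g n)   ∎
    where open ≡-Reasoning

sumBelow-const : ∀ n c → sumBelow n (const c) ≡ n * c
sumBelow-const zero    c = refl
sumBelow-const (suc n) c = trans (cong (_+ c) (sumBelow-const n c)) (+-comm (n * c) c)

sumBelow-unroll : ∀ n f → sumBelow (suc n) f ≡ f 0 + sumBelow n (f ∘ suc)
sumBelow-unroll zero    f = +-comm 0 (f 0)
sumBelow-unroll (suc n) f = trans (cong (_+ f (suc n)) (sumBelow-unroll n f)) (+-assoc (f 0) _ _)

sumBelow-rotate : ∀ n f → f n ≡ f 0 → sumBelow n (f ∘ suc) ≡ sumBelow n f
sumBelow-rotate n f fn≡f0 = +-cancelˡ-≡ (f 0) _ _ (begin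
  f 0 + sumBelow n (f ∘ suc)  ≡⟨ sumBelow-unroll n f ⟨
  sumBelow n f + f n          ≡⟨ cong (sumBelow n f +_) fn≡f0 ⟩
  sumBelow n f + f 0          ≡⟨ +-comm (sumBelow n f) (f 0) ⟩
  f 0 + sumBelow n f          ∎)
  where open ≡-Reasoning

sumBelow-shift : ∀ n f → (∀ x → f (n + x) ≡ f x) → ∀ a → sumBelow n (λ x → f (a + x)) ≡ sumBelow n f
sumBelow-shift n f periodic zero    = refl
sumBelow-shift n f periodic (suc a) =
  trans (sumBelow-shift n (f ∘ suc) (λ x → trans (cong f (sym (+-suc n x))) (periodic (suc x))) a)
        (sumBelow-rotate n f (trans (cong f (sym (+-identityʳ n))) (periodic 0)))

sumBelow-pigeonhole : ∀ n f → sumBelow n f < n → ∃[ x ] x < n × f x ≡ 0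
sumBelow-pigeonhole (suc n) f sum<1+n with f n in fn≡
... | zero  = n , ≤-refl , fn≡
... | suc v with sumBelow-pigeonhole n f (<-≤-trans (m<m+n _ z<s) (s≤s⁻¹ sum<1+n))
...   | x , x<n , fx≡0 = x , m<n⇒m<1+n x<n , fx≡0

sumBelow-sum-tabulate : ∀ {t} n (f : Fin t → ℕ → ℕ) →
  sumBelow n (λ x → sum (tabulate λ i → f i x)) ≡ sum (tabulate λ i → sumBelow n (f i))
sumBelow-sum-tabulate {zero}  n f = trans (sumBelow-const n 0) (*-zeroʳ n)
sumBelow-sum-tabulate {suc t} n f =
  trans (sumBelow-distrib-+ n) (cong (sumBelow n (f fzero) +_) (sumBelow-sum-tabulate n (f ∘ fsuc)))

sum-tabulate-≡0 : ∀ {t} (f : Fin t → ℕ) → sum (tabulate f) ≡ 0 → ∀ i → f i ≡ 0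
sum-tabulate-≡0 f sum≡0 fzero    = m+n≡0⇒m≡0 (f fzero) sum≡0
sum-tabulate-≡0 f sum≡0 (fsuc i) = sum-tabulate-≡0 (f ∘ fsuc) (m+n≡0⇒n≡0 (f fzero) sum≡0) i

sum-tabulate-mono : ∀ {t} {f g : Fin t → ℕ} → (∀ i → f i ≤ g i) → sum (tabulate f) ≤ sum (tabulate g)
sum-tabulate-mono {zero}  f≤g = z≤n
sum-tabulate-mono {suc t} f≤g = +-mono-≤ (f≤g fzero) (sum-tabulate-mono (f≤g ∘ fsuc))

sum-tabulate-complement : ∀ {t} c (f : Fin t → ℕ) → (∀ i → f i ≤ c) →
  sum (tabulate λ i → c ∸ f i) + sum (tabulate f) ≡ t * c
sum-tabulate-complement {zero}  c f f≤c = refl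
sum-tabulate-complement {suc t} c f f≤c = begin
  (c ∸ f fzero + X) + (f fzero + F)   ≡⟨ +-interchange (c ∸ f fzero) X (f fzero) F ⟩
  (c ∸ f fzero + f fzero) + (X + F)   ≡⟨ cong₂ _+_ (m∸n+n≡m (f≤c fzero)) (sum-tabulate-complement c (f ∘ fsuc) (f≤c ∘ fsuc)) ⟩
  c + t * c                           ∎
  where
  open ≡-Reasoning
  X F : ℕ
  X = sum (tabulate λ i → c ∸ f (fsuc i))
  F = sum (tabulate (f ∘ fsuc))

total-slack< : ∀ p {t} (k : Fin t → ℕ) → (∀ i → k i ≤ p ∸ 2) → (p ∸ 2) * t + 1 ≤ sum (tabulate k) + p →
  sum (tabulate λ i → p ∸ suc (suc (k i))) < p
total-slack< p {t} k k≤ enough = +-cancelʳ-≤ (sum (tabulate k)) _ p (begin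
  suc (sum (tabulate λ i → p ∸ suc (suc (k i))) + sum (tabulate k))
    ≡⟨ cong (λ X → suc (X + sum (tabulate k))) (cong sum (tabulate-cong λ i → ∸-+-assoc p 2 (k i))) ⟨
  suc (sum (tabulate λ i → p ∸ 2 ∸ k i) + sum (tabulate k))  ≡⟨ cong suc (sum-tabulate-complement (p ∸ 2) k k≤) ⟩
  suc (t * (p ∸ 2))                                          ≡⟨ cong suc (*-comm t (p ∸ 2)) ⟩
  suc ((p ∸ 2) * t)                                          ≡⟨ +-comm 1 ((p ∸ 2) * t) ⟩
  (p ∸ 2) * t + 1                                            ≤⟨ enough ⟩
  sum (tabulate k) + p                                       ≡⟨ +-comm (sum (tabulate k)) p ⟩
  p + sum (tabulate k)                                       ∎)
  where open ≤-Reasoning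

prefixSum : ∀ {n} → (Fin n → ℕ) → Fin (suc n) → ℕ
prefixSum         e fzero    = 0
prefixSum {suc n} e (fsuc l) = e fzero + prefixSum (e ∘ fsuc) l

prefixSum-suc : ∀ {n} (e : Fin n → ℕ) j → prefixSum e (fsuc j) ≡ prefixSum e (inject₁ j) + e j
prefixSum-suc e fzero    = +-comm (e fzero) 0
prefixSum-suc e (fsuc j) = trans (cong (e fzero +_) (prefixSum-suc (e ∘ fsuc) j)) (sym (+-assoc (e fzero) _ _))

prefixSum-last : ∀ {n} (e : Fin n → ℕ) → prefixSum e (fromℕ n) ≡ sum (tabulate e)
prefixSum-last {zero}  e = refl
prefixSum-last {suc n} e = cong (e fzero +_) (prefixSum-last (e ∘ fsuc))

indicator : Bool → ℕ
indicator true  = 1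
indicator false = 0

count : ℕ → (ℕ → Bool) → ℕ
count n P = sumBelow n (indicator ∘ P)

module _ {P : ℕ → Bool} where

  count-all : ∀ n → (∀ {x} → x < n → T (P x)) → count n P ≡ n
  count-all n all = begin
    count n P            ≡⟨ sumBelow-cong n (λ x<n → indicator-T (all x<n)) ⟩
    sumBelow n (const 1) ≡⟨ sumBelow-const n 1 ⟩
    n * 1                ≡⟨ *-identityʳ n ⟩
    n                    ∎
    where
    open ≡-Reasoning
    indicator-T : ∀ {b} → T b → indicator b ≡ 1
    indicator-T {true} _ = refl

  count-witness : ∀ n → 0 < count n P → ∃[ x ] T (P x)
  count-witness (suc n) 0<count with P n in Pn≡
  ... | true  = n , subst T (sym Pn≡) _
  ... | false = count-witness n (subst (0 <_) (+-identityʳ _) 0<count)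

  count-pos : ∀ n {y} → y < n → T (P y) → 0 < count n P
  count-pos (suc n) {y} y<1+n Py with m<1+n⇒m<n∨m≡n y<1+n
  ... | inj₁ y<n  = <-≤-trans (count-pos n y<n Py) (m≤m+n _ _)
  ... | inj₂ refl = <-≤-trans (indicator-pos (P n) Py) (m≤n+m _ _)
    where
    indicator-pos : ∀ b → T b → 0 < indicator b
    indicator-pos true _ = z<s

  count-complement : ∀ n → count n P + count n (not ∘ P) ≡ n
  count-complement n = begin
    count n P + count n (not ∘ P)                               ≡⟨ sumBelow-distrib-+ n ⟨
    sumBelow n (λ x → indicator (P x) + indicator (not (P x)))  ≡⟨ sumBelow-cong n (λ _ → indicator-+-not (P _)) ⟩
    sumBelow n (const 1)                                        ≡⟨ sumBelow-const n 1 ⟩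
    n * 1                                                       ≡⟨ *-identityʳ n ⟩
    n                                                           ∎
    where
    open ≡-Reasoning
    indicator-+-not : ∀ b → indicator b + indicator (not b) ≡ 1
    indicator-+-not true  = refl
    indicator-+-not false = refl

  count-shift : ∀ n → (∀ x → P (n + x) ≡ P x) → ∀ a → count n (λ x → P (a + x)) ≡ count n P
  count-shift n periodic = sumBelow-shift n (indicator ∘ P) (cong indicator ∘ periodic)

  module _ {Q : ℕ → Bool} where

    private
      indicator-∨ : ∀ a b → indicator a ≤ indicator (a ∨ b)
      indicator-∨ true  b = ≤-refl
      indicator-∨ false b = z≤n

    count-∨-≤ : ∀ n → count n P ≤ count n (λ x → P x ∨ Q x)
    count-∨-≤ n = sumBelow-mono-≤ n (λ {x} _ → indicator-∨ (P x) (Q x))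

    count-∨-< : ∀ n {y} → y < n → T (Q y) → ¬ T (P y) → count n P < count n (λ x → P x ∨ Q x)
    count-∨-< n {y} y<n Qy ¬Py = sumBelow-mono-< n (λ {x} _ → indicator-∨ (P x) (Q x)) y<n (growth (P y) (Q y) Qy ¬Py)
      where
      growth : ∀ a b → T b → ¬ T a → indicator a < indicator (a ∨ b)
      growth false true _ _ = s≤s z≤n
      growth true  _    _ ¬a = ⊥-elim (¬a _)

count-common : ∀ {t} n (P : Fin t → ℕ → Bool) →
  sum (tabulate λ i → count n (not ∘ P i)) < n → ∃[ c ] (∀ i → T (P i c))
count-common n P few-failures = c , λ i → indicator-not≡0 (P i c) (sum-tabulate-≡0 _ (proj₂ (proj₂ found)) i)
  where
  failures : ℕ → ℕ
  failures c = sum (tabulate λ i → indicator (not (P i c)))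
  found : ∃[ c ] c < n × failures c ≡ 0
  found = sumBelow-pigeonhole n failures
    (subst (_< n) (sym (sumBelow-sum-tabulate n λ i → indicator ∘ not ∘ P i)) few-failures)
  c : ℕ
  c = proj₁ found
  indicator-not≡0 : ∀ b → indicator (not b) ≡ 0 → T b
  indicator-not≡0 true _ = _

-- Arithmetic modulo p

module Modular (p : ℕ) .{{_ : NonZero p}} where

  infix 4 _≈_
  record _≈_ (a b : ℕ) : Set where
    constructor mod
    field %-≡ : a % p ≡ b % p
  open _≈_ public

  ≈-refl : ∀ {a} → a ≈ a
  ≈-refl = mod refl

  ≈-sym : ∀ {a b} → a ≈ b → b ≈ a
  ≈-sym (mod e) = mod (sym e)

  ≈-trans : ∀ {a b c} → a ≈ b → b ≈ c → a ≈ c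
  ≈-trans (mod e) (mod f) = mod (trans e f)

  ≡⇒≈ : ∀ {a b} → a ≡ b → a ≈ b
  ≡⇒≈ refl = ≈-refl

  ≈-setoid : Setoid 0ℓ 0ℓ
  ≈-setoid = record
    { Carrier       = ℕ
    ; _≈_           = _≈_
    ; isEquivalence = record { refl = ≈-refl ; sym = ≈-sym ; trans = ≈-trans }
    }

  module ≈-Reasoning = SetoidReasoning ≈-setoid

  +-cong : ∀ {a b c d} → a ≈ b → c ≈ d → a + c ≈ b + d
  +-cong {a} {b} {c} {d} (mod a≈b) (mod c≈d) = mod (begin
    (a + c) % p           ≡⟨ %-distribˡ-+ a c p ⟩
    (a % p + c % p) % p   ≡⟨ cong₂ (λ x y → (x + y) % p) a≈b c≈d ⟩
    (b % p + d % p) % p   ≡⟨ %-distribˡ-+ b d p ⟨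
    (b + d) % p           ∎)
    where open ≡-Reasoning

  *-cong : ∀ {a b c d} → a ≈ b → c ≈ d → a * c ≈ b * d
  *-cong {a} {b} {c} {d} (mod a≈b) (mod c≈d) = mod (begin
    (a * c) % p             ≡⟨ %-distribˡ-* a c p ⟩
    (a % p * (c % p)) % p   ≡⟨ cong₂ (λ x y → (x * y) % p) a≈b c≈d ⟩
    (b % p * (d % p)) % p   ≡⟨ %-distribˡ-* b d p ⟨
    (b * d) % p             ∎)
    where open ≡-Reasoning

  +-congˡ : ∀ a {c d} → c ≈ d → a + c ≈ a + d
  +-congˡ a = +-cong (≈-refl {a})

  +-congʳ : ∀ c {a b} → a ≈ b → a + c ≈ b + c
  +-congʳ c a≈b = +-cong a≈b (≈-refl {c})

  *-congˡ : ∀ a {c d} → c ≈ d → a * c ≈ a * d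
  *-congˡ a = *-cong (≈-refl {a})

  *-congʳ : ∀ c {a b} → a ≈ b → a * c ≈ b * c
  *-congʳ c a≈b = *-cong a≈b (≈-refl {c})

  +-period : ∀ a → a + p ≈ a
  +-period a = mod (trans (cong (λ q → (a + q) % p) (sym (+-identityʳ p))) ([m+kn]%n≡m%n a 1 p))

  %-≈ : ∀ a → a % p ≈ a
  %-≈ a = mod (m%n%n≡m%n a p)

  ≈-<⇒≡ : ∀ {a b} → a < p → b < p → a ≈ b → a ≡ b
  ≈-<⇒≡ a<p b<p (mod e) = trans (sym (m<n⇒m%n≡m a<p)) (trans e (m<n⇒m%n≡m b<p))

  negate : ℕ → ℕ
  negate x = (p ∸ 1) * x

  negate-+ : ∀ x → negate x + x ≈ 0
  negate-+ x = mod (begin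
    ((p ∸ 1) * x + x) % p   ≡⟨ cong (_% p) (+-comm ((p ∸ 1) * x) x) ⟩
    (suc (p ∸ 1) * x) % p   ≡⟨ cong (λ q → (q * x) % p) (suc-pred p) ⟩
    (p * x) % p             ≡⟨ cong (_% p) (*-comm p x) ⟩
    (x * p) % p             ≡⟨ [m+kn]%n≡m%n 0 x p ⟩
    0 % p                   ∎)
    where open ≡-Reasoning

  +-+negate : ∀ a c → a + c + negate c ≈ a
  +-+negate a c = begin
    a + c + negate c    ≡⟨ x+y+z≡x+[z+y] a c (negate c) ⟩
    a + (negate c + c)  ≈⟨ +-congˡ a (negate-+ c) ⟩
    a + 0               ≡⟨ +-identityʳ a ⟩
    a                   ∎
    where open ≈-Reasoning

  +negate≈0⇒≈ : ∀ {a b} → a + negate b ≈ 0 → a ≈ b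
  +negate≈0⇒≈ {a} {b} a-b≈0 = begin
    a                   ≈⟨ +-+negate a b ⟨
    a + b + negate b    ≡⟨ x+y+z≡x+z+y a b (negate b) ⟩
    a + negate b + b    ≈⟨ +-congʳ b a-b≈0 ⟩
    0 + b               ≡⟨ +-identityˡ b ⟩
    b                   ∎
    where open ≈-Reasoning

  +-cancelʳ : ∀ c {a b} → a + c ≈ b + c → a ≈ b
  +-cancelʳ c {a} {b} a+c≈b+c = begin
    a                   ≈⟨ +-+negate a c ⟨
    a + c + negate c    ≈⟨ +-congʳ (negate c) a+c≈b+c ⟩
    b + c + negate c    ≈⟨ +-+negate b c ⟩
    b                   ∎
    where open ≈-Reasoning

  0%p≡0 : 0 % p ≡ 0
  0%p≡0 = m<n⇒m%n≡m (>-nonZero⁻¹ p)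

  ≈0⇒∣ : ∀ {a} → a ≈ 0 → p ∣ a
  ≈0⇒∣ {a} (mod e) = m%n≡0⇒n∣m a p (trans e 0%p≡0)

  ∣⇒≈0 : ∀ {a} → p ∣ a → a ≈ 0
  ∣⇒≈0 {a} p∣a = mod (trans (n∣m⇒m%n≡0 a p p∣a) (sym 0%p≡0))

  +-multiple : ∀ a k → a + k * p ≈ a
  +-multiple a k = mod ([m+kn]%n≡m%n a k p)

  <p⇒≉0 : ∀ {a} → 0 < a → a < p → ¬ a ≈ 0
  <p⇒≉0 0<a a<p a≈0 = <⇒≢ 0<a (sym (≈-<⇒≡ a<p (>-nonZero⁻¹ p) a≈0))

  module _ (p-prime : Prime p) where

    *-≉0 : ∀ {a b} → ¬ a ≈ 0 → ¬ b ≈ 0 → ¬ a * b ≈ 0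
    *-≉0 {a} {b} a≉0 b≉0 ab≈0 with euclidsLemma a b p-prime (≈0⇒∣ ab≈0)
    ... | inj₁ p∣a = a≉0 (∣⇒≈0 p∣a)
    ... | inj₂ p∣b = b≉0 (∣⇒≈0 p∣b)

    inverse : ∀ {e} → ¬ e ≈ 0 → ∃[ u ] u * e ≈ 1
    inverse {e} e≉0 with coprime-Bézout (prime⇒coprime p-prime {{≢-nonZero e%p≢0}} (m%n<n e p))
      where
      e%p≢0 : e % p ≢ 0
      e%p≢0 e%p≡0 = e≉0 (mod (trans e%p≡0 (sym 0%p≡0)))
    ... | Bézout.-+ x y 1+xp≡ye% = y , (begin
      y * e            ≈⟨ *-congˡ y (%-≈ e) ⟨
      y * (e % p)      ≡⟨ 1+xp≡ye% ⟨
      1 + x * p        ≈⟨ +-multiple 1 x ⟩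
      1                ∎)
      where open ≈-Reasoning
    ... | Bézout.+- x y 1+ye%≡xp = negate y , +-cancelʳ (p ∸ 1) (begin
      negate y * e + (p ∸ 1)          ≡⟨ cong₂ _+_ (*-assoc (p ∸ 1) y e) (sym (*-identityʳ (p ∸ 1))) ⟩
      (p ∸ 1) * (y * e) + (p ∸ 1) * 1 ≡⟨ *-distribˡ-+ (p ∸ 1) (y * e) 1 ⟨
      (p ∸ 1) * (y * e + 1)           ≈⟨ *-congˡ (p ∸ 1) ye+1≈0 ⟩
      (p ∸ 1) * 0                     ≡⟨ *-zeroʳ (p ∸ 1) ⟩
      0                               ≈⟨ negate-+ 1 ⟨
      (p ∸ 1) * 1 + 1                 ≡⟨ cong (_+ 1) (*-identityʳ (p ∸ 1)) ⟩
      (p ∸ 1) + 1                     ≡⟨ +-comm (p ∸ 1) 1 ⟩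
      1 + (p ∸ 1)                     ∎)
      where
      open ≈-Reasoning
      ye+1≈0 : y * e + 1 ≈ 0
      ye+1≈0 = begin
        y * e + 1           ≈⟨ +-congʳ 1 (*-congˡ y (%-≈ e)) ⟨
        y * (e % p) + 1     ≡⟨ +-comm (y * (e % p)) 1 ⟩
        1 + y * (e % p)     ≡⟨ 1+ye%≡xp ⟩
        x * p               ≡⟨ +-identityˡ (x * p) ⟩
        0 + x * p           ≈⟨ +-multiple 0 x ⟩
        0                   ∎

  -- The number of forward steps from i to j round a p-cycle, plus p to avoid truncated subtraction.
  steps : Fin p → Fin p → ℕ
  steps i j = toℕ j + p ∸ toℕ i

  steps-+ : ∀ i j → steps i j + toℕ i ≡ toℕ j + p
  steps-+ i j = m∸n+n≡m (≤-trans (<⇒≤ (toℕ<n i)) (m≤n+m p (toℕ j)))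

  steps-self : ∀ i → steps i i ≈ 0
  steps-self i = begin
    toℕ i + p ∸ toℕ i  ≡⟨ m+n∸m≡n (toℕ i) p ⟩
    p                  ≡⟨ +-identityˡ p ⟨
    0 + p              ≈⟨ +-period 0 ⟩
    0                  ∎
    where open ≈-Reasoning

  Next⇒≈suc : ∀ {j j′} → Next p j j′ → toℕ j′ ≈ toℕ j + 1
  Next⇒≈suc {j} (inj₁ j′≡1+j) = ≡⇒≈ (trans j′≡1+j (+-comm 1 (toℕ j)))
  Next⇒≈suc {j} {j′} (inj₂ (1+j≡p , j′≡0)) = begin
    toℕ j′         ≡⟨ j′≡0 ⟩
    0              ≈⟨ +-period 0 ⟨
    p              ≡⟨ 1+j≡p ⟨
    suc (toℕ j)    ≡⟨ +-comm 1 (toℕ j) ⟩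
    toℕ j + 1      ∎
    where open ≈-Reasoning

  steps-Next : ∀ i {j j′} → Next p j j′ → steps i j′ ≈ steps i j + 1
  steps-Next i {j} {j′} j→j′ = +-cancelʳ (toℕ i) (begin
    steps i j′ + toℕ i        ≡⟨ steps-+ i j′ ⟩
    toℕ j′ + p                ≈⟨ +-period (toℕ j′) ⟩
    toℕ j′                    ≈⟨ Next⇒≈suc j→j′ ⟩
    toℕ j + 1                 ≈⟨ +-congʳ 1 (+-period (toℕ j)) ⟨
    toℕ j + p + 1             ≡⟨ cong (_+ 1) (steps-+ i j) ⟨
    steps i j + toℕ i + 1     ≡⟨ x+y+z≡x+z+y (steps i j) (toℕ i) 1 ⟩
    steps i j + 1 + toℕ i     ∎)
    where open ≈-Reasoning

  steps-≉0 : ∀ {i j} → i ≢ j → ¬ steps i j ≈ 0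
  steps-≉0 {i} {j} i≢j steps≈0 = i≢j (toℕ-injective (≈-<⇒≡ (toℕ<n i) (toℕ<n j) (begin
    toℕ i                ≡⟨ +-identityˡ (toℕ i) ⟨
    0 + toℕ i            ≈⟨ +-congʳ (toℕ i) steps≈0 ⟨
    steps i j + toℕ i    ≡⟨ steps-+ i j ⟩
    toℕ j + p            ≈⟨ +-period (toℕ j) ⟩
    toℕ j                ∎)))
    where open ≈-Reasoning

  sign : Bool → ℕ
  sign true  = 1
  sign false = p ∸ 1

  signedSum : ∀ {n} → (Fin n → Bool) → (Fin n → ℕ) → ℕ
  signedSum s d = sum (tabulate λ j → sign (s j) * d j)

  Adjacent : ℕ → ℕ → Set
  Adjacent a b = b ≈ a + 1 ⊎ a ≈ b + 1

  Adjacent-sym : ∀ {a b} → Adjacent a b → Adjacent b a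
  Adjacent-sym (inj₁ b≈a+1) = inj₂ b≈a+1
  Adjacent-sym (inj₂ a≈b+1) = inj₁ a≈b+1

  Adjacent-cong : ∀ {a a′ b b′} → a ≈ a′ → b ≈ b′ → Adjacent a b → Adjacent a′ b′
  Adjacent-cong a≈a′ b≈b′ (inj₁ b≈a+1) = inj₁ (≈-trans (≈-sym b≈b′) (≈-trans b≈a+1 (+-congʳ 1 a≈a′)))
  Adjacent-cong a≈a′ b≈b′ (inj₂ a≈b+1) = inj₂ (≈-trans (≈-sym a≈a′) (≈-trans a≈b+1 (+-congʳ 1 b≈b′)))

  +sign⇒Adjacent : ∀ s {a b} → b ≈ a + sign s → Adjacent a b
  +sign⇒Adjacent true  b≈a+1 = inj₁ b≈a+1
  +sign⇒Adjacent false {a} {b} b≈a+p-1 = inj₂ (begin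
    a                   ≈⟨ +-period a ⟨
    a + p               ≡⟨ cong (a +_) (m∸n+n≡m (>-nonZero⁻¹ p)) ⟨
    a + (p ∸ 1 + 1)     ≡⟨ +-assoc a (p ∸ 1) 1 ⟨
    a + (p ∸ 1) + 1     ≈⟨ +-congʳ 1 b≈a+p-1 ⟨
    b + 1               ∎)
    where open ≈-Reasoning

-- Signed sums of nonzero residues

module SignedSums (p : ℕ) .{{_ : NonZero p}} (p-prime : Prime p) (2<p : 2 < p) where
  open Modular p

  -- T (reachable n d x) says that x + signedSum s d ≈ 0 for some signs s.
  reachable : ∀ n → (Fin n → ℕ) → ℕ → Bool
  reachable zero    d x = x % p ≡ᵇ 0
  reachable (suc n) d x = after true ∨ after false
    where
    after : Bool → Bool
    after s = reachable n (d ∘ fsuc) (sign s * d fzero + x)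

  reachable-cong : ∀ n d {x y} → x ≈ y → reachable n d x ≡ reachable n d y
  reachable-cong zero    d (mod x%p≡y%p) = cong (_≡ᵇ 0) x%p≡y%p
  reachable-cong (suc n) d x≈y =
    cong₂ _∨_ (reachable-cong n (d ∘ fsuc) (+-congˡ _ x≈y)) (reachable-cong n (d ∘ fsuc) (+-congˡ _ x≈y))

  reachable⇒signs : ∀ n d x → T (reachable n d x) → ∃[ s ] x + signedSum s d ≈ 0
  reachable⇒signs zero    d x x%p≡ᵇ0 =
    (λ ()) , mod (trans (cong (_% p) (+-identityʳ x)) (trans (≡ᵇ⇒≡ _ 0 x%p≡ᵇ0) (sym 0%p≡0)))
  reachable⇒signs (suc n) d x reached = [ extend true , extend false ] (Equivalence.to T-∨ reached)
    where
    extend : ∀ s₀ → T (reachable n (d ∘ fsuc) (sign s₀ * d fzero + x)) → ∃[ s ] x + signedSum s d ≈ 0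
    extend s₀ reached′ with reachable⇒signs n (d ∘ fsuc) _ reached′
    ... | s , sum≈0 = (λ { fzero → s₀ ; (fsuc j) → s j }) ,
                      ≈-trans (≡⇒≈ (trans (x+[y+z]≡y+[x+z] x a (signedSum s (d ∘ fsuc))) (sym (+-assoc a x _)))) sum≈0
      where
      a : ℕ
      a = sign s₀ * d fzero

  closed⇒total : (A : ℕ → Bool) → (∀ {x y} → x ≈ y → A x ≡ A y) → ∀ {e} → ¬ e ≈ 0 →
                 (∀ x → T (A (e + x)) → T (A x)) → ∀ {y} → T (A y) → ∀ z → T (A z)
  closed⇒total A A-cong {e} e≉0 down {y} Ay z = descend k z (subst T (A-cong (≈-sym ke+z≈y)) Ay)
    where
    descend : ∀ k x → T (A (k * e + x)) → T (A x)
    descend zero    x Ax           = Ax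
    descend (suc k) x A[e+ke+x] = descend k x (down (k * e + x) (subst (T ∘ A) (+-assoc e (k * e) x) A[e+ke+x]))
    u : ℕ
    u = proj₁ (inverse p-prime e≉0)
    k : ℕ
    k = u * (y + negate z)
    ke+z≈y : k * e + z ≈ y
    ke+z≈y = begin
      u * (y + negate z) * e + z    ≡⟨ cong (_+ z) (x*y*z≡x*z*y u (y + negate z) e) ⟩
      u * e * (y + negate z) + z    ≈⟨ +-congʳ z (*-cong (proj₂ (inverse p-prime e≉0)) ≈-refl) ⟩
      1 * (y + negate z) + z        ≡⟨ cong (_+ z) (*-identityˡ _) ⟩
      y + negate z + z              ≡⟨ +-assoc y (negate z) z ⟩
      y + (negate z + z)            ≈⟨ +-congˡ y (negate-+ z) ⟩
      y + 0                         ≡⟨ +-identityʳ y ⟩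
      y                             ∎
      where open ≈-Reasoning

  count-reachable-shift : ∀ n d a → count p (λ x → reachable n d (a + x)) ≡ count p (reachable n d)
  count-reachable-shift n d = count-shift p (λ x → reachable-cong n d (≈-trans (≡⇒≈ (+-comm p x)) (+-period x)))

  -- Either B adds a residue outside A, or B ⊆ A makes A closed under x ↦ x − e and hence total.
  count-translate-∨ : (A : ℕ → Bool) → (∀ {x y} → x ≈ y → A x ≡ A y) → ∀ {e} → ¬ e ≈ 0 →
    ∀ {B} → (∀ x → A (e + x) ≡ B x) → 0 < count p A → count p A < p → count p A < count p (λ x → A x ∨ B x)
  count-translate-∨ A A-cong {e} e≉0 {B} A[e+x]≡Bx 0<count count<p
    with anyUpTo? (λ y → T? (B y) ×-dec ¬? (T? (A y))) p
  ... | yes (y , y<p , By , ¬Ay) = count-∨-< {A} {B} p y<p By ¬Ay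
  ... | no B⊈A = contradiction (count-all {A} p λ _ → A-total _) (<⇒≢ count<p)
    where
    B-cong : ∀ {x y} → x ≈ y → B x ≡ B y
    B-cong {x} {y} x≈y = trans (sym (A[e+x]≡Bx x)) (trans (A-cong (+-congˡ e x≈y)) (A[e+x]≡Bx y))
    B⊆A : ∀ x → T (B x) → T (A x)
    B⊆A x Bx = subst T (A-cong (%-≈ x)) (decidable-stable (T? (A (x % p)))
      λ ¬A[x%p] → B⊈A (x % p , m%n<n x p , subst T (B-cong (≈-sym (%-≈ x))) Bx , ¬A[x%p]))
    A-total : ∀ z → T (A z)
    A-total = closed⇒total A A-cong e≉0 (λ x → B⊆A x ∘ subst T (A[e+x]≡Bx x)) (proj₂ (count-witness p 0<count))

  count-reachable : ∀ n d → n < p → (∀ j → ¬ d j ≈ 0) → suc n ≤ count p (reachable n d)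
  count-reachable zero    d _     _   = count-pos p (>-nonZero⁻¹ p) (≡⇒≡ᵇ _ 0 0%p≡0)
  count-reachable (suc n) d 1+n<p d≉0 = grow (count p A <? p)
    where
    R : ℕ → Bool
    R = reachable n (d ∘ fsuc)
    A B : ℕ → Bool
    A x = R (sign true * d fzero + x)
    B x = R (sign false * d fzero + x)

    R-cong : ∀ {x y} → x ≈ y → R x ≡ R y
    R-cong = reachable-cong n (d ∘ fsuc)

    count-A : suc n ≤ count p A
    count-A = subst (suc n ≤_) (sym (count-reachable-shift n (d ∘ fsuc) (sign true * d fzero)))
                    (count-reachable n (d ∘ fsuc) (<-trans (n<1+n n) 1+n<p) (d≉0 ∘ fsuc))

    e : ℕ
    e = (p ∸ 2) * d fzero

    e≉0 : ¬ e ≈ 0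
    e≉0 = *-≉0 p-prime (<p⇒≉0 (m<n⇒0<n∸m 2<p) (∸-monoʳ-< {p} {2} {0} z<s (<⇒≤ 2<p))) (d≉0 fzero)

    A[e+x]≡Bx : ∀ x → A (e + x) ≡ B x
    A[e+x]≡Bx x = cong R (begin
      1 * d fzero + (e + x)         ≡⟨ cong (_+ (e + x)) (*-identityˡ (d fzero)) ⟩
      d fzero + (e + x)             ≡⟨ +-assoc (d fzero) e x ⟨
      (1 + (p ∸ 2)) * d fzero + x   ≡⟨ cong (λ c → c * d fzero + x) (+-∸-assoc 1 (<⇒≤ 2<p)) ⟨
      (p ∸ 1) * d fzero + x         ∎)
      where open ≡-Reasoning

    grow : Dec (count p A < p) → suc (suc n) ≤ count p (λ x → A x ∨ B x)
    grow (yes count<p) = ≤-<-trans count-A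
      (count-translate-∨ A (R-cong ∘ +-congˡ _) e≉0 A[e+x]≡Bx (<-≤-trans z<s count-A) count<p)
    grow (no count≮p)  = <-≤-trans 1+n<p (≤-trans (≮⇒≥ count≮p) (count-∨-≤ {A} {B} p))

  common-shift : ∀ {t} (n : Fin t → ℕ) (d : ∀ i → Fin (n i) → ℕ) → (∀ i j → ¬ d i j ≈ 0) →
    (∀ i → n i < p) → sum (tabulate λ i → p ∸ suc (n i)) < p →
    (a : Fin t → ℕ) → ∃[ c ] (∀ i → ∃[ s ] a i + c + signedSum s (d i) ≈ 0)
  common-shift n d d≉0 n<p few-failures a =
    map₂ (λ {c} all-reach i → reachable⇒signs (n i) (d i) (a i + c) (all-reach i))
         (count-common p P (≤-<-trans (sum-tabulate-mono failures≤) few-failures))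
    where
    P : Fin _ → ℕ → Bool
    P i c = reachable (n i) (d i) (a i + c)
    failures≤ : ∀ i → count p (not ∘ P i) ≤ p ∸ suc (n i)
    failures≤ i = begin
      count p (not ∘ P i)                                  ≡⟨ m+n∸m≡n (count p (P i)) _ ⟨
      count p (P i) + count p (not ∘ P i) ∸ count p (P i)  ≡⟨ cong (_∸ count p (P i)) (count-complement p) ⟩
      p ∸ count p (P i)                                    ≤⟨ ∸-monoʳ-≤ p count-P ⟩
      p ∸ suc (n i)                                        ∎
      where
      open ≤-Reasoning
      count-P : suc (n i) ≤ count p (P i)
      count-P = subst (suc (n i) ≤_) (sym (count-reachable-shift (n i) (d i) (a i)))
                      (count-reachable (n i) (d i) (n<p i) (d≉0 i))

-- Colours

module Colouring (h : ℕ) where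

  p : ℕ
  p = suc (h + h)

  open Modular p

  colour : ℕ → Fin p
  colour a = fromℕ< (m%n<n (a * h) p)

  colour-cong : ∀ {a b} → a ≈ b → colour a ≡ colour b
  colour-cong {a} {b} a≈b = toℕ-injective (begin
    toℕ (colour a)  ≡⟨ toℕ-fromℕ< _ ⟩
    (a * h) % p     ≡⟨ %-≡ (*-congʳ h a≈b) ⟩
    (b * h) % p     ≡⟨ toℕ-fromℕ< _ ⟨
    toℕ (colour b)  ∎)
    where open ≡-Reasoning

  CpOK-intro : ∀ {α β : Fin p} → ∣ toℕ α - toℕ β ∣ ≡ h ⊎ ∣ toℕ α - toℕ β ∣ ≡ suc h → CpOK p α β
  CpOK-intro {α} {β} d≡h⊎1+h with bounds d≡h⊎1+h
    where
    bounds : ∀ {d} → d ≡ h ⊎ d ≡ suc h → h ≤ d × d ≤ suc h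
    bounds (inj₁ refl) = ≤-refl , n≤1+n h
    bounds (inj₂ refl) = n≤1+n h , ≤-refl
  ... | h≤d , d≤1+h =
    subst (_≤ 2 * ∣ toℕ α - toℕ β ∣) (cong (h +_) (+-identityʳ h)) (*-monoʳ-≤ 2 h≤d) ,
    ≤-trans (*-monoʳ-≤ 2 d≤1+h) (≤-reflexive (2[1+h]≡p+1 h))
    where
    2[1+h]≡p+1 : ∀ h → 2 * suc h ≡ suc (h + h) + 1
    2[1+h]≡p+1 = solve-∀

  CpOK-sym : ∀ {α β : Fin p} → CpOK p α β → CpOK p β α
  CpOK-sym {α} {β} = subst (λ d → p ∸ 1 ≤ 2 * d × 2 * d ≤ p + 1) (∣-∣-comm (toℕ α) (toℕ β))

  distance-+h : ∀ {A} → A < p → ∣ A - (A + h) % p ∣ ≡ h ⊎ ∣ A - (A + h) % p ∣ ≡ suc h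
  distance-+h {A} A<p with A + h <? p
  ... | yes A+h<p = inj₁ (begin
    ∣ A - (A + h) % p ∣  ≡⟨ cong ∣ A -_∣ (m<n⇒m%n≡m A+h<p) ⟩
    ∣ A - A + h ∣        ≡⟨ m≤n⇒∣m-n∣≡n∸m (m≤m+n A h) ⟩
    A + h ∸ A            ≡⟨ m+n∸m≡n A h ⟩
    h                    ∎)
    where open ≡-Reasoning
  ... | no A+h≮p = inj₂ (begin
    ∣ A - (A + h) % p ∣           ≡⟨ cong (λ x → ∣ A - x % p ∣) A+h≡ ⟩
    ∣ A - (A ∸ suc h + 1 * p) % p ∣ ≡⟨ cong ∣ A -_∣ ([m+kn]%n≡m%n (A ∸ suc h) 1 p) ⟩
    ∣ A - (A ∸ suc h) % p ∣       ≡⟨ cong ∣ A -_∣ (m<n⇒m%n≡m (≤-<-trans (m∸n≤m A (suc h)) A<p)) ⟩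
    ∣ A - (A ∸ suc h) ∣           ≡⟨ m≤n⇒∣n-m∣≡n∸m (m∸n≤m A (suc h)) ⟩
    A ∸ (A ∸ suc h)               ≡⟨ m∸[m∸n]≡n 1+h≤A ⟩
    suc h                         ∎)
    where
    open ≡-Reasoning
    1+h≤A : suc h ≤ A
    1+h≤A = +-cancelʳ-≤ h (suc h) A (≮⇒≥ A+h≮p)
    A+h≡ : A + h ≡ A ∸ suc h + 1 * p
    A+h≡ = begin
      A + h                       ≡⟨ cong (_+ h) (m∸n+n≡m 1+h≤A) ⟨
      A ∸ suc h + suc h + h       ≡⟨ +-assoc (A ∸ suc h) (suc h) h ⟩
      A ∸ suc h + p               ≡⟨ cong (A ∸ suc h +_) (*-identityˡ p) ⟨
      A ∸ suc h + 1 * p           ∎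

  colour-+1 : ∀ {a b} → b ≈ a + 1 → CpOK p (colour a) (colour b)
  colour-+1 {a} {b} b≈a+1 =
    CpOK-intro {colour a} {colour b} (subst (λ d → d ≡ h ⊎ d ≡ suc h) (sym distance≡) (distance-+h (m%n<n (a * h) p)))
    where
    A : ℕ
    A = (a * h) % p
    bh≈A+h : b * h ≈ A + h
    bh≈A+h = begin
      b * h          ≈⟨ *-congʳ h b≈a+1 ⟩
      (a + 1) * h    ≡⟨ *-distribʳ-+ h a 1 ⟩
      a * h + 1 * h  ≡⟨ cong (a * h +_) (*-identityˡ h) ⟩
      a * h + h      ≈⟨ +-congʳ h (%-≈ (a * h)) ⟨
      A + h          ∎
      where open ≈-Reasoning
    distance≡ : ∣ toℕ (colour a) - toℕ (colour b) ∣ ≡ ∣ A - (A + h) % p ∣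
    distance≡ = cong₂ ∣_-_∣ (toℕ-fromℕ< (m%n<n (a * h) p)) (trans (toℕ-fromℕ< (m%n<n (b * h) p)) (%-≡ bh≈A+h))

  colour-Adjacent : ∀ {a b} → Adjacent a b → CpOK p (colour a) (colour b)
  colour-Adjacent (inj₁ b≈a+1) = colour-+1 b≈a+1
  colour-Adjacent {a} {b} (inj₂ a≈b+1) = CpOK-sym {colour b} {colour a} (colour-+1 a≈b+1)

  colour-surjective : Prime p → 0 < h → ∀ ω → ∃[ a ] colour a ≡ ω
  colour-surjective p-prime 0<h ω with inverse p-prime (<p⇒≉0 0<h (s≤s (m≤m+n h h)))
  ... | u , uh≈1 = toℕ ω * u , toℕ-injective (begin
    toℕ (colour (toℕ ω * u))  ≡⟨ toℕ-fromℕ< _ ⟩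
    (toℕ ω * u * h) % p       ≡⟨ %-≡ (≡⇒≈ (*-assoc (toℕ ω) u h)) ⟩
    (toℕ ω * (u * h)) % p     ≡⟨ %-≡ (*-congˡ (toℕ ω) uh≈1) ⟩
    (toℕ ω * 1) % p           ≡⟨ cong (_% p) (*-identityʳ (toℕ ω)) ⟩
    toℕ ω % p                 ≡⟨ m<n⇒m%n≡m (toℕ<n ω) ⟩
    toℕ ω                     ∎)
    where open ≡-Reasoning

-- Labelling necklaces

module Labelling (p : ℕ) .{{_ : NonZero p}} (G : Graph) where
  open Modular p

  span : ∀ {u w} → Piece G p u w → ℕ
  span (edge _)              = 1
  span (cyc _ _ i₁ i₂ _ _)   = steps i₁ i₂

  span-≉0 : ∀ {u w} (P : Piece G p u w) → 1 < p → u ≢ w → ¬ span P ≈ 0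
  span-≉0 (edge _)                  1<p _   = <p⇒≉0 z<s 1<p
  span-≉0 (cyc _ _ i₁ i₂ c₁≡u c₂≡w) _   u≢w = steps-≉0 {i₁} {i₂} λ { refl → u≢w (trans (sym c₁≡u) c₂≡w) }

  pieceLabel : ∀ {u w} (P : Piece G p u w) → ℕ → Bool → ∀ {z} → PieceV P z → ℕ
  pieceLabel (edge _)            base s (inj₁ _) = base
  pieceLabel (edge _)            base s (inj₂ _) = base + sign s * 1
  pieceLabel (cyc _ _ i₁ _ _ _)  base s (q , _)  = base + sign s * steps i₁ q

  start∈piece : ∀ {u w} (P : Piece G p u w) → PieceV P u
  start∈piece (edge _)                 = inj₁ refl
  start∈piece (cyc _ _ i₁ _ c₁≡u _)    = i₁ , sym c₁≡u

  end∈piece : ∀ {u w} (P : Piece G p u w) → PieceV P w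
  end∈piece (edge _)                   = inj₂ refl
  end∈piece (cyc _ _ _ i₂ _ c₂≡w)      = i₂ , sym c₂≡w

  module _ (base : ℕ) (s : Bool) where

    pieceLabel-start : ∀ {u w} (P : Piece G p u w) → u ≢ w → ∀ {z} (pv : PieceV P z) → z ≡ u →
                       pieceLabel P base s pv ≈ base
    pieceLabel-start (edge _) _   (inj₁ _)   _   = ≈-refl
    pieceLabel-start (edge _) u≢w (inj₂ z≡w) z≡u = ⊥-elim (u≢w (trans (sym z≡u) z≡w))
    pieceLabel-start (cyc _ (c-inj , _) _ _ c₁≡u _) _ (q , z≡cq) z≡u
      with c-inj (trans (sym z≡cq) (trans z≡u (sym c₁≡u)))
    ... | refl = begin
      base + sign s * steps q q  ≈⟨ +-congˡ base (*-congˡ (sign s) (steps-self q)) ⟩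
      base + sign s * 0          ≡⟨ cong (base +_) (*-zeroʳ (sign s)) ⟩
      base + 0                   ≡⟨ +-identityʳ base ⟩
      base                       ∎
      where open ≈-Reasoning

    pieceLabel-end : ∀ {u w} (P : Piece G p u w) → u ≢ w → ∀ {z} (pv : PieceV P z) → z ≡ w →
                     pieceLabel P base s pv ≈ base + sign s * span P
    pieceLabel-end (edge _) u≢w (inj₁ z≡u) z≡w = ⊥-elim (u≢w (trans (sym z≡u) z≡w))
    pieceLabel-end (edge _) _   (inj₂ _)   _   = ≈-refl
    pieceLabel-end (cyc _ (c-inj , _) _ _ _ c₂≡w) _ (q , z≡cq) z≡w
      with c-inj (trans (sym z≡cq) (trans z≡w (sym c₂≡w)))
    ... | refl = ≈-refl

    pieceLabel-irrelevant : ∀ {u w} (P : Piece G p u w) → u ≢ w → ∀ {z} (pv pv′ : PieceV P z) →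
                            pieceLabel P base s pv ≈ pieceLabel P base s pv′
    pieceLabel-irrelevant (edge _) _   (inj₁ _)   (inj₁ _)   = ≈-refl
    pieceLabel-irrelevant (edge _) u≢w (inj₁ z≡u) (inj₂ z≡w) = ⊥-elim (u≢w (trans (sym z≡u) z≡w))
    pieceLabel-irrelevant (edge _) u≢w (inj₂ z≡w) (inj₁ z≡u) = ⊥-elim (u≢w (trans (sym z≡u) z≡w))
    pieceLabel-irrelevant (edge _) _   (inj₂ _)   (inj₂ _)   = ≈-refl
    pieceLabel-irrelevant (cyc _ (c-inj , _) _ _ _ _) _ (q , z≡cq) (q′ , z≡cq′)
      with c-inj (trans (sym z≡cq) z≡cq′)
    ... | refl = ≈-refl

    edge-step : base + sign s * 1 ≈ base + sign s
    edge-step = ≡⇒≈ (cong (base +_) (*-identityʳ (sign s)))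

    cycle-step : ∀ i₁ {i j} → Next p i j → base + sign s * steps i₁ j ≈ base + sign s * steps i₁ i + sign s
    cycle-step i₁ {i} {j} i→j = begin
      base + sign s * steps i₁ j                   ≈⟨ +-congˡ base (*-congˡ (sign s) (steps-Next i₁ i→j)) ⟩
      base + sign s * (steps i₁ i + 1)             ≡⟨ cong (base +_) (*-distribˡ-+ (sign s) (steps i₁ i) 1) ⟩
      base + (sign s * steps i₁ i + sign s * 1)    ≡⟨ +-assoc base _ _ ⟨
      base + sign s * steps i₁ i + sign s * 1      ≡⟨ cong (base + sign s * steps i₁ i +_) (*-identityʳ (sign s)) ⟩
      base + sign s * steps i₁ i + sign s          ∎
      where open ≈-Reasoning

    pieceLabel-edge : ∀ {u w} (P : Piece G p u w) → ∀ {a b} → PieceE P a b →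
      Σ (PieceV P a) λ pa → Σ (PieceV P b) λ pb → Adjacent (pieceLabel P base s pa) (pieceLabel P base s pb)
    pieceLabel-edge (edge _) (inj₁ (a≡u , b≡w)) = inj₁ a≡u , inj₂ b≡w , +sign⇒Adjacent s edge-step
    pieceLabel-edge (edge _) (inj₂ (a≡w , b≡u)) =
      inj₂ a≡w , inj₁ b≡u , Adjacent-sym (+sign⇒Adjacent s edge-step)
    pieceLabel-edge (cyc _ _ i₁ _ _ _) (i , j , i→j , inj₁ (a≡ci , b≡cj)) =
      (i , a≡ci) , (j , b≡cj) , +sign⇒Adjacent s (cycle-step i₁ i→j)
    pieceLabel-edge (cyc _ _ i₁ _ _ _) (i , j , i→j , inj₂ (a≡cj , b≡ci)) =
      (j , a≡cj) , (i , b≡ci) , Adjacent-sym (+sign⇒Adjacent s (cycle-step i₁ i→j))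

  module _ {m a b} (N : Necklace G p m a b) where
    open Necklace N using (v; v-inj; v-start; v-end; piece; disjoint)

    spans : Fin (suc m) → ℕ
    spans j = span (piece j)

    ends-distinct : ∀ j → v (inject₁ j) ≢ v (fsuc j)
    ends-distinct j v≡v = <⇒≢ (n<1+n (toℕ j)) (trans (sym (toℕ-inject₁ j)) (cong toℕ (v-inj v≡v)))

    path-vertex-piece : ∀ l → Σ[ j ∈ Fin (suc m) ] PieceV (piece j) (v l) × (l ≡ inject₁ j ⊎ l ≡ fsuc j)
    path-vertex-piece fzero    = fzero , start∈piece (piece fzero) , inj₁ refl
    path-vertex-piece (fsuc j) = j , end∈piece (piece j) , inj₂ refl

    end∈necklace : NV N b
    end∈necklace = fromℕ m , subst (PieceV (piece (fromℕ m))) v-end (end∈piece (piece (fromℕ m)))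

    module _ (base : ℕ) (s : Fin (suc m) → Bool) where

      increments : Fin (suc m) → ℕ
      increments j = sign (s j) * spans j

      pathLabel : Fin (suc (suc m)) → ℕ
      pathLabel l = base + prefixSum increments l

      label : ∀ {z} → NV N z → ℕ
      label (j , pv) = pieceLabel (piece j) (pathLabel (inject₁ j)) (s j) pv

      label-at-end : ∀ {z} j (pv : PieceV (piece j) z) l → z ≡ v l → l ≡ inject₁ j ⊎ l ≡ fsuc j →
                     label (j , pv) ≈ pathLabel l
      label-at-end j pv l z≡vl (inj₁ refl) = pieceLabel-start _ (s j) (piece j) (ends-distinct j) pv z≡vl
      label-at-end j pv l z≡vl (inj₂ refl) = begin
        label (j , pv)                                           ≈⟨ pieceLabel-end _ (s j) (piece j) (ends-distinct j) pv z≡vl ⟩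
        pathLabel (inject₁ j) + increments j                     ≡⟨ +-assoc base _ _ ⟩
        base + (prefixSum increments (inject₁ j) + increments j) ≡⟨ cong (base +_) (prefixSum-suc increments j) ⟨
        pathLabel (fsuc j)                                       ∎
        where open ≈-Reasoning

      label-path : ∀ {z} (r : NV N z) l → z ≡ v l → label r ≈ pathLabel l
      label-path (j , pv) l z≡vl with path-vertex-piece l
      ... | j₀ , pv₀ , l-end-of-j₀ with j ≟ j₀
      ...   | yes refl = label-at-end j pv l z≡vl l-end-of-j₀
      ...   | no j≢j₀ with disjoint j j₀ j≢j₀ _ pv (subst (PieceV (piece j₀)) (sym z≡vl) pv₀)
      ...     | l′ , z≡vl′ , l′-end-of-j , _ with v-inj (trans (sym z≡vl′) z≡vl)
      ...       | refl = label-at-end j pv l′ z≡vl′ l′-end-of-j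

      label-irrelevant : ∀ {z} (r r′ : NV N z) → label r ≈ label r′
      label-irrelevant (j , pv) (j′ , pv′) with j ≟ j′
      ... | yes refl = pieceLabel-irrelevant _ (s j) (piece j) (ends-distinct j) pv pv′
      ... | no j≢j′ with disjoint j j′ j≢j′ _ pv pv′
      ...   | l , z≡vl , _ = ≈-trans (label-path (j , pv) l z≡vl) (≈-sym (label-path (j′ , pv′) l z≡vl))

      label-edge : ∀ {x y} → NE N x y → Σ (NV N x) λ rx → Σ (NV N y) λ ry → Adjacent (label rx) (label ry)
      label-edge (j , e) with pieceLabel-edge (pathLabel (inject₁ j)) (s j) (piece j) e
      ... | px , py , adjacent = (j , px) , (j , py) , adjacent

      label-start : ∀ {z} (r : NV N z) → z ≡ a → label r ≈ base
      label-start r z≡a = ≈-trans (label-path r fzero (trans z≡a (sym v-start))) (≡⇒≈ (+-identityʳ base))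

      label-end : ∀ {z} (r : NV N z) → z ≡ b → label r ≈ base + signedSum s spans
      label-end r z≡b = ≈-trans (label-path r (fromℕ (suc m)) (trans z≡b (sym v-end)))
                                (≡⇒≈ (cong (base +_) (prefixSum-last increments)))

-- Extending a colouring of the end vertices

module Extensions (h : ℕ) (p-prime : Prime (suc (h + h))) (0<h : 0 < h) (H : Graph) where
  open Colouring h
  open Modular p
  open SignedSums p p-prime (s≤s (+-mono-≤ 0<h 0<h))
  open Labelling p H

  target : Fin p → ℕ
  target ω = proj₁ (colour-surjective p-prime 0<h ω)

  colour-target : ∀ ω → colour (target ω) ≡ ω
  colour-target ω = proj₂ (colour-surjective p-prime 0<h ω)

  module _ {t} {x : Fin t → Vtx H} (ω : Fin t → Fin p) where

    Extension : Set
    Extension = Σ (Vtx H → Fin p) λ φ → IsCpColoring H p φ × (∀ i → φ (x i) ≡ ω i)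

    extension-from-labelling : {Rep : Vtx H → Set} (val : ∀ {z} → Rep z → ℕ) →
      (∀ {z} (r r′ : Rep z) → val r ≈ val r′) → (cover : ∀ z → Rep z) →
      (∀ {u w} → E H u w → Σ (Rep u) λ ru → Σ (Rep w) λ rw → Adjacent (val ru) (val rw)) →
      (∀ i → Σ (Rep (x i)) λ r → val r ≈ target (ω i)) → Extension
    extension-from-labelling val agree cover edges ends = colour ∘ val ∘ cover , coloured , extends
      where
      coloured : IsCpColoring H p (colour ∘ val ∘ cover)
      coloured u w uw with edges uw
      ... | ru , rw , adjacent = colour-Adjacent (Adjacent-cong (agree ru (cover u)) (agree rw (cover w)) adjacent)
      extends : ∀ i → colour (val (cover (x i))) ≡ ω i
      extends i with ends i
      ... | r , r≈target = trans (colour-cong (≈-trans (agree (cover (x i)) r) r≈target)) (colour-target (ω i))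

    -- Opaque: only the existence of the base matters, and unfolding it during with-abstraction
    -- in the two cases below makes type checking blow up.
    opaque
      choose-signs : ∀ {k : Fin t → ℕ} {start : Fin t → Vtx H} (neck : ∀ i → Necklace H p (k i) (start i) (x i)) →
        (∀ i → k i ≤ p ∸ 2) → (p ∸ 2) * t + 1 ≤ sum (tabulate k) + p → (offset : Fin t → ℕ) →
        ∃[ c ] ∀ i → ∃[ s ] c + offset i + signedSum s (spans (neck i)) ≈ target (ω i)
      choose-signs {k} neck k≤ enough offset =
        map₂ (λ {c} reach i → map₂ (close {offset i} {target (ω i)} {c}) (reach i))
             (common-shift (suc ∘ k) (spans ∘ neck) spans≉0 pieces<p (total-slack< p k k≤ enough)
                           (λ i → offset i + negate (target (ω i))))
        where
        spans≉0 : ∀ i j → ¬ spans (neck i) j ≈ 0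
        spans≉0 i j = span-≉0 (Necklace.piece (neck i) j) (s≤s (≤-trans 0<h (m≤m+n h h))) (ends-distinct (neck i) j)
        pieces<p : ∀ i → suc (k i) < p
        pieces<p i = s≤s (≤-trans (s≤s (k≤ i)) (≤-reflexive (m+[n∸m]≡n {1} {h + h} (≤-trans 0<h (m≤m+n h h)))))
        close : ∀ {o T c S} → o + negate T + c + S ≈ 0 → c + o + S ≈ T
        close {o} {T} {c} {S} sum≈0 = +negate≈0⇒≈ (≈-trans (≡⇒≈ (rearrange c o (negate T) S)) sum≈0)
          where
          rearrange : ∀ c o n S → c + o + S + n ≡ o + n + c + S
          rearrange = solve-∀

    module Necklaces {k : Fin t → ℕ} {start : Fin t → Vtx H} (neck : ∀ i → Necklace H p (k i) (start i) (x i))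
        (coherent : ∀ i j → x i ≡ x j → ω i ≡ ω j) (offset : Fin t → ℕ) (c : ℕ)
        (signs : ∀ i → ∃[ s ] c + offset i + signedSum s (spans (neck i)) ≈ target (ω i)) where

      base : Fin t → ℕ
      base i = c + offset i

      s : ∀ i → Fin (suc (k i)) → Bool
      s i = proj₁ (signs i)

      Member : Vtx H → Set
      Member z = Σ[ i ∈ Fin t ] NV (neck i) z

      ℓ : ∀ {z} → Member z → ℕ
      ℓ (i , r) = label (neck i) (base i) (s i) r

      ℓ-same : ∀ {z} i (r r′ : NV (neck i) z) → ℓ (i , r) ≈ ℓ (i , r′)
      ℓ-same i = label-irrelevant (neck i) (base i) (s i)

      ℓ-start : ∀ {z} i (r : NV (neck i) z) → z ≡ start i → ℓ (i , r) ≈ base i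
      ℓ-start i = label-start (neck i) (base i) (s i)

      ℓ-end : ∀ {z} i (r : NV (neck i) z) → z ≡ x i → ℓ (i , r) ≈ target (ω i)
      ℓ-end i r z≡xi = ≈-trans (label-end (neck i) (base i) (s i) r z≡xi) (proj₂ (signs i))

      ℓ-shared-end : ∀ {z i i′} (r : NV (neck i) z) (r′ : NV (neck i′) z) → z ≡ x i → z ≡ x i′ →
                     ℓ (i , r) ≈ ℓ (i′ , r′)
      ℓ-shared-end {i = i} {i′} r r′ z≡xi z≡xi′ = begin
        ℓ (i , r)          ≈⟨ ℓ-end i r z≡xi ⟩
        target (ω i)       ≡⟨ cong target (coherent i i′ (trans (sym z≡xi) z≡xi′)) ⟩
        target (ω i′)      ≈⟨ ℓ-end i′ r′ z≡xi′ ⟨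
        ℓ (i′ , r′)        ∎
        where open ≈-Reasoning

      ℓ-edge : ∀ i {u w} → NE (neck i) u w → Σ (Member u) λ mu → Σ (Member w) λ mw → Adjacent (ℓ mu) (ℓ mw)
      ℓ-edge i e with label-edge (neck i) (base i) (s i) e
      ... | ru , rw , adjacent = (i , ru) , (i , rw) , adjacent

      ℓ-target : ∀ i → Σ (Member (x i)) λ m → ℓ m ≈ target (ω i)
      ℓ-target i = (i , end∈necklace (neck i)) , ℓ-end i (end∈necklace (neck i)) refl

  multiNecklace-extension : ∀ {t k x} → (∀ i → k i ≤ p ∸ 2) → (p ∸ 2) * t + 1 ≤ sum (tabulate k) + p →
    IsMultiNecklace H p t k x → (ω : Fin t → Fin p) → (∀ i j → x i ≡ x j → ω i ≡ ω j) → Extension ω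
  multiNecklace-extension k≤ enough MN ω coherent = extension-from-labelling ω ℓ agree coverV edges ℓ-target
    where
    open IsMultiNecklace MN
    chosen : ∃[ c ] ∀ i → ∃[ s ] c + 0 + signedSum s (spans (neck i)) ≈ target (ω i)
    chosen = choose-signs ω neck k≤ enough (const 0)
    open Necklaces ω neck coherent (const 0) (proj₁ chosen) (proj₂ chosen)

    agree : ∀ {z} (m m′ : Member z) → ℓ m ≈ ℓ m′
    agree (i , r) (i′ , r′) with i ≟ i′
    ... | yes refl = ℓ-same i r r′
    ... | no i≢i′ with disjoint i i′ i≢i′ _ r r′
    ...   | inj₁ z≡y              = ≈-trans (ℓ-start i r z≡y) (≈-sym (ℓ-start i′ r′ z≡y))
    ...   | inj₂ (z≡xi , z≡xi′)   = ℓ-shared-end r r′ z≡xi z≡xi′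

    edges : ∀ {u w} → E H u w → Σ (Member u) λ mu → Σ (Member w) λ mw → Adjacent (ℓ mu) (ℓ mw)
    edges uw with coverE _ _ uw
    ... | i , e = ℓ-edge i e

  crownNecklace-extension : ∀ {t k x} → (∀ i → k i ≤ p ∸ 2) → (p ∸ 2) * t + 1 ≤ sum (tabulate k) + p →
    IsCrownNecklace H p t k x → (ω : Fin t → Fin p) → (∀ i j → x i ≡ x j → ω i ≡ ω j) → Extension ω
  crownNecklace-extension k≤ enough CN ω coherent =
    extension-from-labelling ω val agree coverV edges λ i → inj₂ (proj₁ (ℓ-target i)) , proj₂ (ℓ-target i)
    where
    open IsCrownNecklace CN
    chosen : ∃[ c ] ∀ i → ∃[ s ] c + toℕ (ys i) + signedSum s (spans (neck i)) ≈ target (ω i)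
    chosen = choose-signs ω neck k≤ enough (toℕ ∘ ys)
    c : ℕ
    c = proj₁ chosen
    open Necklaces ω neck coherent (toℕ ∘ ys) c (proj₂ chosen)

    Q-inj : ∀ {q q′} → Q q ≡ Q q′ → q ≡ q′
    Q-inj = proj₁ Q-cycle

    Rep : Vtx H → Set
    Rep z = CycV H p Q z ⊎ Member z

    val : ∀ {z} → Rep z → ℕ
    val (inj₁ (q , _)) = c + toℕ q
    val (inj₂ m)       = ℓ m

    crown-necklace : ∀ {z q i} → z ≡ Q q → (r : NV (neck i) z) → c + toℕ q ≈ ℓ (i , r)
    crown-necklace {i = i} z≡Qq r with Q-inj (trans (sym z≡Qq) (meetQ i _ r (_ , z≡Qq)))
    ... | refl = ≈-sym (ℓ-start i r z≡Qq)

    agree : ∀ {z} (r r′ : Rep z) → val r ≈ val r′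
    agree (inj₁ (q , z≡Qq)) (inj₁ (q′ , z≡Qq′)) with Q-inj (trans (sym z≡Qq) z≡Qq′)
    ... | refl = ≈-refl
    agree (inj₁ (q , z≡Qq)) (inj₂ (i , r)) = crown-necklace z≡Qq r
    agree (inj₂ (i , r)) (inj₁ (q , z≡Qq)) = ≈-sym (crown-necklace z≡Qq r)
    agree (inj₂ (i , r)) (inj₂ (i′ , r′)) with i ≟ i′
    ... | yes refl = ℓ-same i r r′
    ... | no i≢i′ with disjoint i i′ i≢i′ _ r r′
    ...   | inj₁ (q , z≡Qq)       = ≈-trans (≈-sym (crown-necklace z≡Qq r)) (crown-necklace z≡Qq r′)
    ...   | inj₂ (z≡xi , z≡xi′)   = ℓ-shared-end r r′ z≡xi z≡xi′

    crown-step : ∀ {q q′} → Next p q q′ → c + toℕ q′ ≈ c + toℕ q + 1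
    crown-step {q} q→q′ = ≈-trans (+-congˡ c (Next⇒≈suc q→q′)) (≡⇒≈ (sym (+-assoc c (toℕ q) 1)))

    edges : ∀ {u w} → E H u w → Σ (Rep u) λ ru → Σ (Rep w) λ rw → Adjacent (val ru) (val rw)
    edges uw with coverE _ _ uw
    ... | inj₁ (q , q′ , q→q′ , inj₁ (u≡Qq , w≡Qq′)) = inj₁ (q , u≡Qq) , inj₁ (q′ , w≡Qq′) , inj₁ (crown-step q→q′)
    ... | inj₁ (q , q′ , q→q′ , inj₂ (u≡Qq′ , w≡Qq)) = inj₁ (q′ , u≡Qq′) , inj₁ (q , w≡Qq) , inj₂ (crown-step q→q′)
    ... | inj₂ (i , e) with ℓ-edge i e
    ...   | mu , mw , adjacent = inj₂ mu , inj₂ mw , adjacent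

halve : ∀ n → ∃[ h ] (n ≡ h + h ⊎ n ≡ suc (h + h))
halve zero    = 0 , inj₁ refl
halve (suc n) with halve n
... | h , inj₁ refl = h , inj₂ refl
... | h , inj₂ refl = suc h , inj₁ (cong suc (sym (+-suc h h)))

odd-prime : ∀ {p} → Prime p → 3 ≤ p → ∃[ h ] p ≡ suc (h + h)
odd-prime {p} p-prime 3≤p with halve p
... | h , inj₂ p≡1+2h = h , p≡1+2h
... | h , inj₁ p≡h+h = ⊥-elim ([ (λ ()) , (λ { refl → contradiction 3≤p λ { (s≤s (s≤s ())) } }) ]′
                                (prime⇒irreducible p-prime 2∣p))
  where
  2∣p : 2 ∣ p
  2∣p = divides h (trans p≡h+h (trans (cong (h +_) (sym (+-identityʳ h))) (*-comm 2 h)))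

lemma3p3 : (p : ℕ) → Prime p → 5 ≤ p →
    (t : ℕ) → 3 ≤ t → (k : Fin t → ℕ) →
    (∀ i → k i ≤ p ∸ 2) →
    (p ∸ 2) * t + 1 ≤ sum (tabulate k) + p →
    (H : Graph) (x : Fin t → Vtx H) →
    IsMultiNecklace H p t k x ⊎ IsCrownNecklace H p t k x →
    (ω : Fin t → Fin p) →
    (∀ i j → x i ≡ x j → ω i ≡ ω j) →
    (∀ i j → E H (x i) (x j) → CpOK p (ω i) (ω j)) →
    Σ (Vtx H → Fin p) (λ φ → IsCpColoring H p φ × (∀ i → φ (x i) ≡ ω i))
lemma3p3 p p-prime 5≤p t _ k k≤ enough H x necklace ω coherent _
  with odd-prime p-prime (≤-trans (s≤s (s≤s (s≤s z≤n))) 5≤p)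
... | zero      , refl = contradiction 5≤p λ { (s≤s ()) }
... | h@(suc _) , refl = [ (λ MN → multiNecklace-extension k≤ enough MN ω coherent)
                         , (λ CN → crownNecklace-extension k≤ enough CN ω coherent) ] necklace
  where open Extensions h p-prime z<s H
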